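{- If $G\in\mathbb{Im}^\infty$ is manoeuvrable, then the set $P_G$ of $G$-protected nimbers is finite.
   Context: Affine normal play forms $\mathbb{Np}^\infty$ are defined recursively: two atomic forms $\infty$ and $\overline{\infty}$ with no options; every other form is $G=\{G^{\mathcal L}\mid G^{\mathcal R}\}$ with finite nonempty sets of previously constructed forms as Left and Right options (short games). Disjunctive sum: $\infty+X=X+\infty=\infty$ for $X\neq\overline{\infty}$; $\overline{\infty}+X=X+\overline{\infty}=\overline{\infty}$ for $X\ne\infty$; $\infty+\overline{\infty}$ undefined; otherwise $G+H=\{G^L+H,G+H^L\mid G^R+H,G+H^R\}$. Outcomes: Left wins $\infty$ and Right wins $\overline{\infty}$ whoever moves; otherwise play alternates, Left moving first wins iff some Left option is won by Left moving second, Left moving second wins iff every Right option is won by Left moving first, symmetrically for Right. $o(G)\in\{\mathscr L,\mathscr N,\mathscr P,\mathscr R\}$: Left wins either way, first player wins, second player wins, Right wins either way. Nimbers: $*0=\{\overline\infty\mid\infty\}$, $*n=\{*0,\dots,*(n-1)\mid *0,\dots,*(n-1)\}$. Conjugate $\overline G$: swaps $\infty,\overline\infty$, otherwise $\{\overline{G^R}\mid\overline{G^L}\}$. $G\notin\{\infty,\overline\infty\}$ is a Left-check if $\infty\in G^{\mathcal L}$, a Right-check if $\overline\infty\in G^{\mathcal R}$; quiet if $G\notin\{\infty,\overline\infty\}$ and neither. Symmetric: $G\notin\{\infty,\overline\infty\}$ and $G^{\mathcal R}=\{\overline{G^L}\}$. Affine impartial ($\mathbb{Im}^\infty$): symmetric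 with all quiet followers symmetric. $G=_{\mathbb{Im}^\infty}H$ iff $o(G+X)=o(H+X)$ for all $X\in\mathbb{Im}^\infty$; a form "is a nimber" if it is $=_{\mathbb{Im}^\infty}$ some $*n$. $P_G$ (protected nimbers) is the set of all nimbers if $\infty\in G^{\mathcal L}$, and otherwise the set of nimbers $*n$ such that some Left option $G^L$ of $G$ that is a Left-check satisfies $o(G^L+*n)=\mathscr L$. A quiet form $G\in\mathbb{Im}^\infty$ is manoeuvrable if after each Left move in $G$ to an option that is neither a nimber nor $\overline\infty$, Right can force, by a sequence of his own checks (Right moves to Right-checks, each of which Left must answer locally), either a Left move to a nimber or a move by either player to $\overline\infty$. -}

module Defs where

open import Data.Nat using (ℕ; zero; suc; _+_; _<_)
open import Data.Fin using (Fin; zero; suc; splitAt)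
open import Data.Bool using (Bool; true; false; _∧_; _∨_)
open import Data.Sum using (_⊎_; inj₁; inj₂; [_,_])
open import Data.Product using (Σ; ∃; _×_; _,_)
open import Data.Unit using (⊤)
open import Data.Empty using (⊥)
open import Relation.Nullary using (¬_)
open import Relation.Binary.PropositionalEquality using (_≡_)

-- A non-atomic form { G^L | G^R } has finite NONEMPTY families of
-- options, given as functions  Fin (suc m) → Form  (Left) and
-- Fin (suc n) → Form  (Right).  Options are regarded as sets: identity
-- of forms is the relation _≅_ below (hereditary set equality).

data Form : Set where
  ∞   : Form
  ∞̄   : Form
  ⟨_∣_⟩ : {m n : ℕ} → (Fin (suc m) → Form) → (Fin (suc n) → Form) → Form

data _≅_ : Form → Form → Set where
  ∞≅∞   : ∞ ≅ ∞
  ∞̄≅∞̄   : ∞̄ ≅ ∞̄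
  ⟨⟩≅   : {m n m' n' : ℕ}
          {f : Fin (suc m) → Form} {g : Fin (suc n) → Form}
          {f' : Fin (suc m') → Form} {g' : Fin (suc n') → Form} →
          (∀ i → ∃ λ i' → f i ≅ f' i') → (∀ i' → ∃ λ i → f i ≅ f' i') →
          (∀ j → ∃ λ j' → g j ≅ g' j') → (∀ j' → ∃ λ j → g j ≅ g' j') →
          ⟨ f ∣ g ⟩ ≅ ⟨ f' ∣ g' ⟩

-- Disjunctive sum.  ∞ + ∞̄ and ∞̄ + ∞ are undefined in the paper; here
-- they are given the junk value ∞ (they never occur in the statement:
-- all sums there have a non-atomic right summand).

infixl 6 _⊕_
_⊕_ : Form → Form → Form
∞ ⊕ ∞̄ = ∞
∞ ⊕ _ = ∞
∞̄ ⊕ ∞ = ∞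
∞̄ ⊕ _ = ∞̄
⟨ f ∣ g ⟩ ⊕ ∞ = ∞
⟨ f ∣ g ⟩ ⊕ ∞̄ = ∞̄
G@(⟨_∣_⟩ {m} {n} f g) ⊕ H@(⟨_∣_⟩ {m'} {n'} f' g') =
  ⟨ (λ k → [ (λ i → f i ⊕ H) , (λ i' → G ⊕ f' i') ] (splitAt (suc m) k))
  ∣ (λ k → [ (λ j → g j ⊕ H) , (λ j' → G ⊕ g' j') ] (splitAt (suc n) k)) ⟩

anyF : {n : ℕ} → (Fin n → Bool) → Bool
anyF {zero}  p = false
anyF {suc n} p = p zero ∨ anyF (λ i → p (suc i))

allF : {n : ℕ} → (Fin n → Bool) → Bool
allF {zero}  p = true
allF {suc n} p = p zero ∧ allF (λ i → p (suc i))

mutual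
  leftFirst : Form → Bool
  leftFirst ∞ = true
  leftFirst ∞̄ = false
  leftFirst ⟨ f ∣ g ⟩ = anyF (λ i → leftSecond (f i))

  leftSecond : Form → Bool
  leftSecond ∞ = true
  leftSecond ∞̄ = false
  leftSecond ⟨ f ∣ g ⟩ = allF (λ j → leftFirst (g j))

mutual
  rightFirst : Form → Bool
  rightFirst ∞ = false
  rightFirst ∞̄ = true
  rightFirst ⟨ f ∣ g ⟩ = anyF (λ j → rightSecond (g j))

  rightSecond : Form → Bool
  rightSecond ∞ = false
  rightSecond ∞̄ = true
  rightSecond ⟨ f ∣ g ⟩ = allF (λ i → rightFirst (f i))

data Outcome : Set where
  𝓛 𝓝 𝓟 𝓡 : Outcome

outcomeOf : Bool → Bool → Outcome
outcomeOf true  true  = 𝓝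
outcomeOf true  false = 𝓛
outcomeOf false true  = 𝓡
outcomeOf false false = 𝓟

o : Form → Outcome
o G = outcomeOf (leftFirst G) (rightFirst G)

mutual
  nim : ℕ → Form
  nim zero    = ⟨_∣_⟩ {0} {0} (λ _ → ∞̄) (λ _ → ∞)
  nim (suc n) = ⟨ nims (suc n) ∣ nims (suc n) ⟩

  -- nims n enumerates *(n-1), …, *0
  nims : (n : ℕ) → Fin n → Form
  nims (suc n) zero    = nim n
  nims (suc n) (suc i) = nims n i

conj : Form → Form
conj ∞ = ∞̄
conj ∞̄ = ∞
conj ⟨ f ∣ g ⟩ = ⟨ (λ j → conj (g j)) ∣ (λ i → conj (f i)) ⟩

IsInf : Form → Set
IsInf ∞ = ⊤
IsInf _ = ⊥

IsNegInf : Form → Set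
IsNegInf ∞̄ = ⊤
IsNegInf _ = ⊥

LeftCheck : Form → Set
LeftCheck ∞ = ⊥
LeftCheck ∞̄ = ⊥
LeftCheck ⟨ f ∣ g ⟩ = ∃ λ i → IsInf (f i)

RightCheck : Form → Set
RightCheck ∞ = ⊥
RightCheck ∞̄ = ⊥
RightCheck ⟨ f ∣ g ⟩ = ∃ λ j → IsNegInf (g j)

Quiet : Form → Set
Quiet ∞ = ⊥
Quiet ∞̄ = ⊥
Quiet G = ¬ LeftCheck G × ¬ RightCheck G

Symmetric : Form → Set
Symmetric ∞ = ⊥
Symmetric ∞̄ = ⊥
Symmetric ⟨ f ∣ g ⟩ =
  (∀ j → ∃ λ i → g j ≅ conj (f i)) × (∀ i → ∃ λ j → g j ≅ conj (f i))

data Follower : Form → Form → Set where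
  here  : ∀ {G} → Follower G G
  viaL  : ∀ {H m n} {f : Fin (suc m) → Form} {g : Fin (suc n) → Form} i →
          Follower H (f i) → Follower H ⟨ f ∣ g ⟩
  viaR  : ∀ {H m n} {f : Fin (suc m) → Form} {g : Fin (suc n) → Form} j →
          Follower H (g j) → Follower H ⟨ f ∣ g ⟩

IsIm : Form → Set
IsIm G = Symmetric G × (∀ H → Follower H G → Quiet H → Symmetric H)

_=Im_ : Form → Form → Set
G =Im H = ∀ X → IsIm X → o (G ⊕ X) ≡ o (H ⊕ X)

IsNimber : Form → Set
IsNimber G = ∃ λ n → G =Im nim n

Protected : Form → ℕ → Set
Protected ∞ n = ⊥
Protected ∞̄ n = ⊥
Protected ⟨ f ∣ g ⟩ n =
  (∃ λ i → IsInf (f i)) ⊎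
  (∃ λ i → LeftCheck (f i) × o (f i ⊕ nim n) ≡ 𝓛)

-- P_G is finite: only finitely many n with *n ∈ P_G
-- (the *n are pairwise distinct modulo Im^∞).
FiniteProtected : Form → Set
FiniteProtected G = ∃ λ N → ∀ n → Protected G n → n < N

-- Manoeuvrability.
-- RightForces X : at X, with Right to move, Right can force by a sequence
-- of his own checks either a Left move to a nimber or a move by either
-- player to ∞̄.

mutual
  data RightForces : Form → Set where
    toNegInf : ∀ {m n} {f : Fin (suc m) → Form} {g : Fin (suc n) → Form}
               (j : Fin (suc n)) → IsNegInf (g j) → RightForces ⟨ f ∣ g ⟩
    check    : ∀ {m n} {f : Fin (suc m) → Form} {g : Fin (suc n) → Form}
               (j : Fin (suc n)) → RightCheck (g j) →
               AllLeftAnswersGood (g j) → RightForces ⟨ f ∣ g ⟩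

  AllLeftAnswersGood : Form → Set
  AllLeftAnswersGood ∞ = ⊥
  AllLeftAnswersGood ∞̄ = ⊥
  AllLeftAnswersGood ⟨ f ∣ g ⟩ = ∀ i → GoodLeftAnswer (f i)

  GoodLeftAnswer : Form → Set
  GoodLeftAnswer Z = IsNimber Z ⊎ IsNegInf Z ⊎ RightForces Z

-- (defined for quiet G ∈ Im^∞; membership in Im^∞ is a separate hypothesis)
Manoeuvrable : Form → Set
Manoeuvrable ∞ = ⊥
Manoeuvrable ∞̄ = ⊥
Manoeuvrable G@(⟨ f ∣ g ⟩) =
  Quiet G ×
  (∀ i → ¬ IsNimber (f i) → ¬ IsNegInf (f i) → RightForces (f i))

-- A Left-check G^L cannot equal a nimber *m, since Left wins G^L + *m moving first while
-- *m + *m is a second-player win; nor is it ∞̄.  So by manoeuvrability Right, moving first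
-- in G^L + *n, plays a chain of checks (any Left reply in *n loses at once to ∞̄) until Left
-- has moved to ∞̄ or to some nimber *m, and Right wins *m + *n moving first when m ≠ n.
-- The finitely many m met along the finitely many such chains bound P_G; quietness of G
-- excludes ∞ ∈ G^L.

module Submission where

open import Defs
open import Data.Bool using (Bool; true; false; T)
open import Data.Bool.Properties using (T-∨; T-∧)
open import Data.Empty using (⊥)
open import Data.Fin using (Fin; zero; suc; splitAt; _↑ˡ_; _↑ʳ_)
open import Data.Fin.Properties using (splitAt-↑ˡ; splitAt-↑ʳ; any?)
open import Data.Nat using (ℕ; zero; suc; _<_; _≤_; _⊔_; s≤s; _<?_)
open import Data.Nat.Induction using (<-rec)
open import Data.Nat.Properties
  using (m≤n⇒m<n∨m≡n; m⊔n≤o⇒m≤o; m⊔n≤o⇒n≤o; ≮⇒≥; <-cmp; n<1+n; m<n⇒m<1+n; <⇒≢)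
open import Data.Product using (∃; _×_; _,_; proj₁; proj₂)
open import Data.Sum using (_⊎_; inj₁; inj₂; [_,_])
open import Data.Unit using (tt)
open import Function using (_∘_; Equivalence)
open import Relation.Binary.Definitions using (tri<; tri≈; tri>)
open import Relation.Binary.PropositionalEquality
  using (_≡_; _≢_; refl; sym; trans; cong; subst)
open import Relation.Nullary using (¬_; Dec; yes; no; contradiction)

open Equivalence using (to; from)

anyF⁺ : ∀ {n} (p : Fin n → Bool) i → T (p i) → T (anyF p)
anyF⁺ p zero    h = from T-∨ (inj₁ h)
anyF⁺ p (suc i) h = from T-∨ (inj₂ (anyF⁺ (p ∘ suc) i h))

anyF⁻ : ∀ {n} (p : Fin n → Bool) → T (anyF p) → ∃ λ i → T (p i)
anyF⁻ {suc n} p h with to T-∨ h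
... | inj₁ h₀ = zero , h₀
... | inj₂ hₛ = let i , hᵢ = anyF⁻ (p ∘ suc) hₛ in suc i , hᵢ

allF⁺ : ∀ {n} (p : Fin n → Bool) → (∀ i → T (p i)) → T (allF p)
allF⁺ {zero}  p h = tt
allF⁺ {suc n} p h = from T-∧ (h zero , allF⁺ (p ∘ suc) (h ∘ suc))

allF⁻ : ∀ {n} (p : Fin n → Bool) → T (allF p) → ∀ i → T (p i)
allF⁻ p h zero    = proj₁ (to T-∧ h)
allF⁻ p h (suc i) = allF⁻ (p ∘ suc) (proj₂ (to T-∧ h)) i

module _ {a b : ℕ} (p : Fin a ⊎ Fin b → Bool) where

  anyF-splitAt⁺ˡ : ∀ i → T (p (inj₁ i)) → T (anyF (p ∘ splitAt a))
  anyF-splitAt⁺ˡ i h = anyF⁺ (p ∘ splitAt a) (i ↑ˡ b) (subst (T ∘ p) (sym (splitAt-↑ˡ a i b)) h)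

  anyF-splitAt⁺ʳ : ∀ j → T (p (inj₂ j)) → T (anyF (p ∘ splitAt a))
  anyF-splitAt⁺ʳ j h = anyF⁺ (p ∘ splitAt a) (a ↑ʳ j) (subst (T ∘ p) (sym (splitAt-↑ʳ a b j)) h)

  allF-splitAt⁺ : (∀ i → T (p (inj₁ i))) → (∀ j → T (p (inj₂ j))) → T (allF (p ∘ splitAt a))
  allF-splitAt⁺ hˡ hʳ = allF⁺ (p ∘ splitAt a) (λ k → [_,_] {C = T ∘ p} hˡ hʳ (splitAt a k))

mutual
  rightSecond⇒¬leftFirst : ∀ X → T (rightSecond X) → ¬ T (leftFirst X)
  rightSecond⇒¬leftFirst ∞ ()
  rightSecond⇒¬leftFirst ∞̄ _ ()
  rightSecond⇒¬leftFirst ⟨ f ∣ g ⟩ r l =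
    let i , lᵢ = anyF⁻ (leftSecond ∘ f) l
    in  rightFirst⇒¬leftSecond (f i) (allF⁻ (rightFirst ∘ f) r i) lᵢ

  rightFirst⇒¬leftSecond : ∀ X → T (rightFirst X) → ¬ T (leftSecond X)
  rightFirst⇒¬leftSecond ∞ ()
  rightFirst⇒¬leftSecond ∞̄ _ ()
  rightFirst⇒¬leftSecond ⟨ f ∣ g ⟩ r l =
    let j , rⱼ = anyF⁻ (rightSecond ∘ g) r
    in  rightSecond⇒¬leftFirst (g j) rⱼ (allF⁻ (leftFirst ∘ g) l j)

leftWinsFirst rightWinsFirst : Outcome → Bool
leftWinsFirst 𝓛 = true
leftWinsFirst 𝓝 = true
leftWinsFirst _ = false
rightWinsFirst 𝓝 = true
rightWinsFirst 𝓡 = true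
rightWinsFirst _ = false

leftWinsFirst-outcomeOf : ∀ a b → leftWinsFirst (outcomeOf a b) ≡ a
leftWinsFirst-outcomeOf true  true  = refl
leftWinsFirst-outcomeOf true  false = refl
leftWinsFirst-outcomeOf false true  = refl
leftWinsFirst-outcomeOf false false = refl

rightWinsFirst-outcomeOf : ∀ a b → rightWinsFirst (outcomeOf a b) ≡ b
rightWinsFirst-outcomeOf true  true  = refl
rightWinsFirst-outcomeOf true  false = refl
rightWinsFirst-outcomeOf false true  = refl
rightWinsFirst-outcomeOf false false = refl

leftWinsFirst-o : ∀ X → leftWinsFirst (o X) ≡ leftFirst X
leftWinsFirst-o X = leftWinsFirst-outcomeOf (leftFirst X) (rightFirst X)

rightWinsFirst-o : ∀ X → rightWinsFirst (o X) ≡ rightFirst X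
rightWinsFirst-o X = rightWinsFirst-outcomeOf (leftFirst X) (rightFirst X)

o≡⇒leftFirst≡ : ∀ X Y → o X ≡ o Y → leftFirst X ≡ leftFirst Y
o≡⇒leftFirst≡ X Y eq =
  trans (sym (leftWinsFirst-o X)) (trans (cong leftWinsFirst eq) (leftWinsFirst-o Y))

o≡⇒rightFirst≡ : ∀ X Y → o X ≡ o Y → rightFirst X ≡ rightFirst Y
o≡⇒rightFirst≡ X Y eq =
  trans (sym (rightWinsFirst-o X)) (trans (cong rightWinsFirst eq) (rightWinsFirst-o Y))

o≡𝓛⇒¬rightFirst : ∀ X → o X ≡ 𝓛 → ¬ T (rightFirst X)
o≡𝓛⇒¬rightFirst X eq = subst T (trans (sym (rightWinsFirst-o X)) (cong rightWinsFirst eq))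

nims⁻ : ∀ {k} i → ∃ λ j → j < k × nims k i ≡ nim j
nims⁻ {suc k} zero    = k , n<1+n k , refl
nims⁻ {suc k} (suc i) = let j , j<k , eq = nims⁻ i in j , m<n⇒m<1+n j<k , eq

nims⁺ : ∀ {j k} → j < k → ∃ λ i → nims k i ≡ nim j
nims⁺ {j} {suc k} (s≤s j≤k) with m≤n⇒m<n∨m≡n j≤k
... | inj₁ j<k  = let i , eq = nims⁺ j<k in suc i , eq
... | inj₂ refl = zero , refl

RightOption : Form → Form → Set
RightOption Y ⟨ f ∣ g ⟩ = ∃ λ j → g j ≡ Y
RightOption Y _         = ⊥

nim-rightOption : ∀ {j k} → j < k → RightOption (nim j) (nim k)
nim-rightOption {k = suc k} = nims⁺

-- A sum with nim k only unfolds once k is split, hence the twin clauses here and below.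
rightFirst-⊕ˡ : ∀ X {X′} k → RightOption X′ X →
                T (rightSecond (X′ ⊕ nim k)) → T (rightFirst (X ⊕ nim k))
rightFirst-⊕ˡ ⟨ f ∣ g ⟩ zero (j , refl) =
  anyF-splitAt⁺ˡ (rightSecond ∘ [ (λ j → g j ⊕ nim zero) , _ ]) j
rightFirst-⊕ˡ ⟨ f ∣ g ⟩ (suc k) (j , refl) =
  anyF-splitAt⁺ˡ (rightSecond ∘ [ (λ j → g j ⊕ nim (suc k)) , _ ]) j

rightFirst-⊕ʳ : ∀ X {j k} → j < k → T (rightSecond (X ⊕ nim j)) → T (rightFirst (X ⊕ nim k))
rightFirst-⊕ʳ ∞ {zero}  _ ()
rightFirst-⊕ʳ ∞ {suc _} _ ()
rightFirst-⊕ʳ ∞̄ {k = suc _} _ _ = tt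
rightFirst-⊕ʳ ⟨ f ∣ g ⟩ {j} {suc k} j<k r =
  let i , eq = nims⁺ j<k
  in  anyF-splitAt⁺ʳ
        (rightSecond ∘ [ (λ j → g j ⊕ nim (suc k)) , (λ i → ⟨ f ∣ g ⟩ ⊕ nims (suc k) i) ]) i
        (subst (λ Y → T (rightSecond (⟨ f ∣ g ⟩ ⊕ Y))) (sym eq) r)

rightSecond-⊕ : ∀ {m n} (f : Fin (suc m) → Form) (g : Fin (suc n) → Form) k →
                (∀ i → T (rightFirst (f i ⊕ nim k))) →
                (∀ {j} → j < k → T (rightFirst (⟨ f ∣ g ⟩ ⊕ nim j))) →
                T (rightSecond (⟨ f ∣ g ⟩ ⊕ nim k))
rightSecond-⊕ f g zero hˡ _ =
  allF-splitAt⁺ (rightFirst ∘ [ (λ i → f i ⊕ nim zero) , _ ]) hˡ _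
rightSecond-⊕ f g (suc k) hˡ hʳ =
  allF-splitAt⁺ (rightFirst ∘ [ (λ i → f i ⊕ nim (suc k)) , _ ]) hˡ λ i →
    let j , j<k , eq = nims⁻ i
    in  subst (λ Y → T (rightFirst (⟨ f ∣ g ⟩ ⊕ Y))) (sym eq) (hʳ j<k)

-- Right mirrors: each Left move to *j + *k or *k + *j is answered by moving to *j + *j.
nim-⊕-self : ∀ k → T (rightSecond (nim k ⊕ nim k))
nim-⊕-self = <-rec (λ k → T (rightSecond (nim k ⊕ nim k))) step
  where
  step : ∀ k → (∀ {j} → j < k → T (rightSecond (nim j ⊕ nim j))) →
         T (rightSecond (nim k ⊕ nim k))
  step zero    _  = tt
  step (suc k) ih = rightSecond-⊕ (nims (suc k)) (nims (suc k)) (suc k)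
    (λ i → let j , j<k , eq = nims⁻ i
           in  subst (λ Y → T (rightFirst (Y ⊕ nim (suc k)))) (sym eq)
                 (rightFirst-⊕ʳ (nim j) j<k (ih j<k)))
    (λ j<k → rightFirst-⊕ˡ (nim (suc k)) _ (nim-rightOption j<k) (ih j<k))

nim-⊕-distinct : ∀ {m n} → m ≢ n → T (rightFirst (nim m ⊕ nim n))
nim-⊕-distinct {m} {n} m≢n with <-cmp m n
... | tri< m<n _ _ = rightFirst-⊕ʳ (nim m) m<n (nim-⊕-self m)
... | tri≈ _ m≡n _ = contradiction m≡n m≢n
... | tri> _ _ n<m = rightFirst-⊕ˡ (nim m) n (nim-rightOption n<m) (nim-⊕-self n)

mutual
  nim≅conj : ∀ k → nim k ≅ conj (nim k)
  nim≅conj zero    = ⟨⟩≅ (λ i → i , ∞̄≅∞̄) (λ i → i , ∞̄≅∞̄) (λ j → j , ∞≅∞) (λ j → j , ∞≅∞)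
  nim≅conj (suc k) = ⟨⟩≅ (λ i → i , nims≅conj i) (λ i → i , nims≅conj i)
                         (λ j → j , nims≅conj j) (λ j → j , nims≅conj j)

  nims≅conj : ∀ {n} i → nims n i ≅ conj (nims n i)
  nims≅conj {suc n} zero    = nim≅conj n
  nims≅conj {suc n} (suc i) = nims≅conj i

nim-symmetric : ∀ k → Symmetric (nim k)
nim-symmetric zero    = (λ _ → zero , ∞≅∞) , (λ _ → zero , ∞≅∞)
nim-symmetric (suc k) = (λ j → j , nims≅conj j) , (λ i → i , nims≅conj i)

mutual
  nim-quiet-followers-symmetric : ∀ k {H} → Follower H (nim k) → Quiet H → Symmetric H
  nim-quiet-followers-symmetric zero    here          _  = nim-symmetric zero
  nim-quiet-followers-symmetric (suc k) here          _  = nim-symmetric (suc k)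
  nim-quiet-followers-symmetric zero    (viaL _ here) ()
  nim-quiet-followers-symmetric zero    (viaR _ here) ()
  nim-quiet-followers-symmetric (suc k) (viaL i h)    = nims-quiet-followers-symmetric i h
  nim-quiet-followers-symmetric (suc k) (viaR j h)    = nims-quiet-followers-symmetric j h

  nims-quiet-followers-symmetric : ∀ {n} i {H} → Follower H (nims n i) → Quiet H → Symmetric H
  nims-quiet-followers-symmetric {suc n} zero    = nim-quiet-followers-symmetric n
  nims-quiet-followers-symmetric {suc n} (suc i) = nims-quiet-followers-symmetric i

nim-Im : ∀ k → IsIm (nim k)
nim-Im k = nim-symmetric k , λ _ → nim-quiet-followers-symmetric k

∞-⊕-nim : ∀ Z k → IsInf Z → Z ⊕ nim k ≡ ∞
∞-⊕-nim ∞ zero    _ = refl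
∞-⊕-nim ∞ (suc k) _ = refl

∞̄-⊕-nim : ∀ Z k → IsNegInf Z → Z ⊕ nim k ≡ ∞̄
∞̄-⊕-nim ∞̄ zero    _ = refl
∞̄-⊕-nim ∞̄ (suc k) _ = refl

leftCheck-leftFirst : ∀ X k → LeftCheck X → T (leftFirst (X ⊕ nim k))
leftCheck-leftFirst ⟨ f ∣ g ⟩ zero (i , fᵢ≡∞) =
  anyF-splitAt⁺ˡ (leftSecond ∘ [ (λ i → f i ⊕ nim zero) , _ ]) i
    (subst (T ∘ leftSecond) (sym (∞-⊕-nim (f i) zero fᵢ≡∞)) tt)
leftCheck-leftFirst ⟨ f ∣ g ⟩ (suc k) (i , fᵢ≡∞) =
  anyF-splitAt⁺ˡ (leftSecond ∘ [ (λ i → f i ⊕ nim (suc k)) , _ ]) i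
    (subst (T ∘ leftSecond) (sym (∞-⊕-nim (f i) (suc k) fᵢ≡∞)) tt)

rightCheck-rightFirst : ∀ X k → RightCheck X → T (rightFirst (X ⊕ nim k))
rightCheck-rightFirst ⟨ f ∣ g ⟩ k (j , gⱼ≡∞̄) =
  rightFirst-⊕ˡ ⟨ f ∣ g ⟩ k (j , refl)
    (subst (T ∘ rightSecond) (sym (∞̄-⊕-nim (g j) k gⱼ≡∞̄)) tt)

leftCheck-not-nimber : ∀ {X} → LeftCheck X → ¬ IsNimber X
leftCheck-not-nimber {X} lc (m , X=*m) =
  rightSecond⇒¬leftFirst (nim m ⊕ nim m) (nim-⊕-self m)
    (subst T (o≡⇒leftFirst≡ (X ⊕ nim m) (nim m ⊕ nim m) (X=*m (nim m) (nim-Im m)))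
             (leftCheck-leftFirst X m lc))

leftCheck-not-∞̄ : ∀ {X} → LeftCheck X → ¬ IsNegInf X
leftCheck-not-∞̄ {⟨ _ ∣ _ ⟩} _ ()

nimber-rightFirst : ∀ X {m n} → X =Im nim m → m ≢ n → T (rightFirst (X ⊕ nim n))
nimber-rightFirst X {m} {n} X=*m m≢n =
  subst T (sym (o≡⇒rightFirst≡ (X ⊕ nim n) (nim m ⊕ nim n) (X=*m (nim n) (nim-Im n))))
          (nim-⊕-distinct m≢n)

Eventually : (ℕ → Set) → Set
Eventually P = ∃ λ B → ∀ n → B ≤ n → P n

eventually-map : ∀ {P Q : ℕ → Set} → (∀ {n} → P n → Q n) → Eventually P → Eventually Q
eventually-map h (B , p) = B , λ n B≤n → h (p n B≤n)

eventually-∀ : ∀ {k} {P : Fin k → ℕ → Set} →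
               (∀ i → Eventually (P i)) → Eventually (λ n → ∀ i → P i n)
eventually-∀ {zero}  _ = 0 , λ _ _ ()
eventually-∀ {suc k} h =
  let B₀ , p₀ = h zero
      B  , p  = eventually-∀ (h ∘ suc)
  in  B₀ ⊔ B , λ { n le zero    → p₀ n (m⊔n≤o⇒m≤o B₀ B le)
                 ; n le (suc i) → p  n (m⊔n≤o⇒n≤o B₀ B le) i }

eventually-guarded : ∀ {A : Set} {P : ℕ → Set} →
                     Dec A → (A → Eventually P) → Eventually (λ n → A → P n)
eventually-guarded (yes a) h = eventually-map (λ p _ → p) (h a)
eventually-guarded (no ¬a) _ = 0 , λ _ _ a → contradiction a ¬a

eventually-¬⇒bounded : ∀ {P : ℕ → Set} → Eventually (λ n → ¬ P n) → ∃ λ N → ∀ n → P n → n < N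
eventually-¬⇒bounded {P} (B , ¬p) = B , bounded
  where
  bounded : ∀ n → P n → n < B
  bounded n p with n <? B
  ... | yes n<B = n<B
  ... | no  n≮B = contradiction p (¬p n (≮⇒≥ n≮B))

mutual
  rightForces-eventually : ∀ {X} → RightForces X → Eventually (λ n → T (rightFirst (X ⊕ nim n)))
  rightForces-eventually {X} (toNegInf j gⱼ≡∞̄) = 0 , λ n _ → rightCheck-rightFirst X n (j , gⱼ≡∞̄)
  rightForces-eventually {X} (check {g = g} j gⱼ-check answers) =
    eventually-map (rightFirst-⊕ˡ X _ (j , refl)) (answers-eventually (g j) gⱼ-check answers)

  answers-eventually : ∀ Y → RightCheck Y → AllLeftAnswersGood Y →
                       Eventually (λ n → T (rightSecond (Y ⊕ nim n)))
  answers-eventually Y@(⟨ f ∣ g ⟩) Y-check answers =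
    eventually-map (λ {n} h → rightSecond-⊕ f g n h (λ {j} _ → rightCheck-rightFirst Y j Y-check))
      (eventually-∀ (λ i → goodAnswer-eventually (f i) (answers i)))

  goodAnswer-eventually : ∀ Z → GoodLeftAnswer Z → Eventually (λ n → T (rightFirst (Z ⊕ nim n)))
  goodAnswer-eventually Z (inj₁ (m , Z=*m)) = suc m , λ n m<n → nimber-rightFirst Z Z=*m (<⇒≢ m<n)
  goodAnswer-eventually Z (inj₂ (inj₁ Z≡∞̄)) =
    0 , λ n _ → subst (T ∘ rightFirst) (sym (∞̄-⊕-nim Z n Z≡∞̄)) tt
  goodAnswer-eventually Z (inj₂ (inj₂ forces)) = rightForces-eventually forces

isInf? : ∀ X → Dec (IsInf X)
isInf? ∞         = yes tt
isInf? ∞̄         = no λ ()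
isInf? ⟨ _ ∣ _ ⟩ = no λ ()

leftCheck? : ∀ X → Dec (LeftCheck X)
leftCheck? ∞         = no λ ()
leftCheck? ∞̄         = no λ ()
leftCheck? ⟨ f ∣ _ ⟩ = any? (isInf? ∘ f)

lemma3p17 : (G : Form) → IsIm G → Manoeuvrable G → FiniteProtected G
lemma3p17 ∞ _ ()
lemma3p17 ∞̄ _ ()
lemma3p17 ⟨ f ∣ g ⟩ _ ((no-∞-option , _) , manoeuvre) =
  eventually-¬⇒bounded (eventually-map unprotected (eventually-∀ checksLose))
  where
  checksLose : ∀ i → Eventually (λ n → LeftCheck (f i) → T (rightFirst (f i ⊕ nim n)))
  checksLose i = eventually-guarded (leftCheck? (f i)) λ lc →
    rightForces-eventually (manoeuvre i (leftCheck-not-nimber lc) (leftCheck-not-∞̄ lc))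

  unprotected : ∀ {n} → (∀ i → LeftCheck (f i) → T (rightFirst (f i ⊕ nim n))) →
                ¬ Protected ⟨ f ∣ g ⟩ n
  unprotected     _ (inj₁ ∞-option)       = no-∞-option ∞-option
  unprotected {n} h (inj₂ (i , lc , o≡𝓛)) = o≡𝓛⇒¬rightFirst (f i ⊕ nim n) o≡𝓛 (h i lc)
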